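{- Let $t$ be the Thue–Morse word, the fixed point starting with $a$ of the morphism $a\mapsto abba$, $b\mapsto baab$. For every $n\ge 1$, $PPL_t(n)=PPL^0_t(4n)\ge PPL_t(4n)$.
   Context: For a word $w$, $w(i..j]=w[i+1]\cdots w[j]$. $PPL_t(n)$ is the minimal number of palindromes whose concatenation is the prefix $t(0..n]$ of length $n$. A factorization $t(0..4n]=t(e_0..e_1]t(e_1..e_2]\cdots t(e_{k-1}..e_k]$ ($0=e_0<e_1<\dots<e_k=4n$) into palindromes is called a $0$-decomposition if every $e_i$ is divisible by $4$ (i.e. all palindromes are of type $(0,0)$). $PPL^0_t(4n)$ is the minimal number of palindromes in a $0$-decomposition of $t(0..4n]$. -}

module Defs where

open import Data.Nat using (ℕ; zero; suc; _+_; _*_; _≤_)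
open import Data.Nat.Divisibility using (_∣_)
open import Data.List using (List; []; _∷_; _++_; concat; concatMap; reverse; length; map; upTo)
open import Data.List.Relation.Unary.All using (All)
open import Data.Product using (Σ; _×_; ∃-syntax)
open import Relation.Binary.PropositionalEquality using (_≡_)
open import Relation.Nullary using (¬_)

data Letter : Set where
  a b : Letter

Word : Set
Word = List Letter

μ-letter : Letter → Word
μ-letter a = a ∷ b ∷ b ∷ a ∷ []
μ-letter b = b ∷ a ∷ a ∷ b ∷ []

μ : Word → Word
μ = concatMap μ-letter

μ^ : ℕ → Word → Word
μ^ zero w = w
μ^ (suc k) w = μ (μ^ k w)

-- i-th letter (0-indexed) of a word, with a default when out of range
nth : Word → ℕ → Letter
nth [] _ = a
nth (x ∷ _) zero = x
nth (_ ∷ xs) (suc i) = nth xs i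

-- The Thue–Morse word t (fixed point of μ starting with a), 0-indexed:
-- letter i is the i-th letter of μ^(i+1)(a), which has length 4^(i+1) > i
-- and is a prefix of the fixed point.
t : ℕ → Letter
t i = nth (μ^ (suc i) (a ∷ [])) i

-- The prefix t(0..n] = t[1] ⋯ t[n] (paper's 1-indexing) = letters 0..n-1 here
prefix : ℕ → Word
prefix n = map t (upTo n)

Palindrome : Word → Set
Palindrome w = reverse w ≡ w

NonEmpty : Word → Set
NonEmpty w = ¬ (w ≡ [])

PalFact : Word → List Word → Set
PalFact w ws = (concat ws ≡ w) × All NonEmpty ws × All Palindrome ws

-- A 0-decomposition: all cut points divisible by 4, i.e. every factor
-- has length divisible by 4
ZeroDecomp : Word → List Word → Set
ZeroDecomp w ws = PalFact w ws × All (λ p → 4 ∣ length p) ws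

IsPPL : Word → ℕ → Set
IsPPL w k = (Σ (List Word) λ ws → PalFact w ws × length ws ≡ k)
          × (∀ ws → PalFact w ws → k ≤ length ws)

PPL-is : ℕ → ℕ → Set
PPL-is n k = IsPPL (prefix n) k

PPL0-is : ℕ → ℕ → Set
PPL0-is m k = (Σ (List Word) λ ws → ZeroDecomp (prefix m) ws × length ws ≡ k)
            × (∀ ws → ZeroDecomp (prefix m) ws → k ≤ length ws)

module Submission where

-- The morphism μ (a ↦ abba, b ↦ baab) is injective, multiplies lengths
-- by 4 and commutes with reversal, so u is a nonempty palindrome iff μ u is.
-- Hence applying μ factor by factor turns a palindromic factorization of w
-- into a 0-decomposition of μ w with the same number of factors, and,
-- conversely, cutting w at the preimages of the cut points (all divisible by
-- 4) turns a 0-decomposition of μ w into a palindromic factorization of w.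
-- So the minimal counts agree: PPL(w) = PPL⁰(μ w) for every word w.  Since a
-- 0-decomposition is in particular a palindromic factorization, also
-- PPL⁰(v) ≥ PPL(v) for every word v.

open import Defs
open import Data.Nat using (ℕ; _*_; _≤_; _≥_)
open import Data.Product using (_×_)
open import Relation.Binary.PropositionalEquality using (_≡_)

open import Function using (_∘_; id)
open import Data.Nat using (zero; suc; _+_; _<_; z≤n; s≤s)
open import Data.Nat.Properties
  using (≤-antisym; ≤-total; ≤-<-trans; <-trans; n<1+n;
         +-comm; *-comm; m<m*n; +-monoʳ-<; *-monoˡ-≤; module ≤-Reasoning)
open import Data.Nat.Divisibility using (divides)
open import Data.List using (List; []; _∷_; _++_; concat; reverse; length; map; take; drop; upTo; applyUpTo)
open import Data.List.Properties
  using (++-assoc; ++-cancelˡ; ++-identityʳ; reverse-++; unfold-reverse; length-map; take++drop≡id; map-applyUpTo)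
open import Data.List.Relation.Unary.All using ([]; _∷_)
open import Data.Product using (Σ; _,_; proj₁)
open import Data.Sum using (inj₁; inj₂)
open import Relation.Binary.PropositionalEquality using (refl; sym; trans; cong; cong₂; subst; module ≡-Reasoning)

μ-++ : ∀ u v → μ (u ++ v) ≡ μ u ++ μ v
μ-++ []      v = refl
μ-++ (x ∷ u) v = trans (cong (μ-letter x ++_) (μ-++ u v)) (sym (++-assoc (μ-letter x) (μ u) (μ v)))

μ-length : ∀ u → length (μ u) ≡ length u * 4
μ-length []      = refl
μ-length (a ∷ u) = cong (4 +_) (μ-length u)
μ-length (b ∷ u) = cong (4 +_) (μ-length u)

-- The images of letters are palindromes, hence μ commutes with reversal.
μ-letter-palindrome : ∀ x → Palindrome (μ-letter x)
μ-letter-palindrome a = refl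
μ-letter-palindrome b = refl

μ-reverse : ∀ u → μ (reverse u) ≡ reverse (μ u)
μ-reverse []      = refl
μ-reverse (x ∷ u) = begin
  μ (reverse (x ∷ u))                     ≡⟨ cong μ (unfold-reverse x u) ⟩
  μ (reverse u ++ x ∷ [])                 ≡⟨ μ-++ (reverse u) (x ∷ []) ⟩
  μ (reverse u) ++ (μ-letter x ++ [])     ≡⟨ cong₂ _++_ (μ-reverse u) (++-identityʳ (μ-letter x)) ⟩
  reverse (μ u) ++ μ-letter x             ≡⟨ cong (reverse (μ u) ++_) (sym (μ-letter-palindrome x)) ⟩
  reverse (μ u) ++ reverse (μ-letter x)   ≡⟨ sym (reverse-++ (μ-letter x) (μ u)) ⟩
  reverse (μ (x ∷ u))                     ∎
  where open ≡-Reasoning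

-- μ is injective: the image of a letter determines the letter.
μ-injective : ∀ u v → μ u ≡ μ v → u ≡ v
μ-injective []      []      _  = refl
μ-injective []      (a ∷ v) ()
μ-injective []      (b ∷ v) ()
μ-injective (a ∷ u) []      ()
μ-injective (b ∷ u) []      ()
μ-injective (a ∷ u) (b ∷ v) ()
μ-injective (b ∷ u) (a ∷ v) ()
μ-injective (a ∷ u) (a ∷ v) e = cong (a ∷_) (μ-injective u v (++-cancelˡ (μ-letter a) (μ u) (μ v) e))
μ-injective (b ∷ u) (b ∷ v) e = cong (b ∷_) (μ-injective u v (++-cancelˡ (μ-letter b) (μ u) (μ v) e))

μ-nonEmpty : ∀ u → NonEmpty u → NonEmpty (μ u)
μ-nonEmpty u u≢[] μu≡[] = u≢[] (μ-injective u [] μu≡[])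

μ-palindrome : ∀ u → Palindrome u → Palindrome (μ u)
μ-palindrome u pal = trans (sym (μ-reverse u)) (cong μ pal)

μ-palindrome⁻ : ∀ u → Palindrome (μ u) → Palindrome u
μ-palindrome⁻ u pal = μ-injective (reverse u) u (trans (μ-reverse u) pal)

μ-take : ∀ m w → take (m * 4) (μ w) ≡ μ (take m w)
μ-take zero    w       = refl
μ-take (suc m) []      = refl
μ-take (suc m) (a ∷ w) = cong (μ-letter a ++_) (μ-take m w)
μ-take (suc m) (b ∷ w) = cong (μ-letter b ++_) (μ-take m w)

μ-drop : ∀ m w → drop (m * 4) (μ w) ≡ μ (drop m w)
μ-drop zero    w       = refl
μ-drop (suc m) []      = refl
μ-drop (suc m) (a ∷ w) = μ-drop m w
μ-drop (suc m) (b ∷ w) = μ-drop m w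

take-length-++ : ∀ (p q : Word) → take (length p) (p ++ q) ≡ p
take-length-++ []      q = refl
take-length-++ (x ∷ p) q = cong (x ∷_) (take-length-++ p q)

drop-length-++ : ∀ (p q : Word) → drop (length p) (p ++ q) ≡ q
drop-length-++ []      q = refl
drop-length-++ (x ∷ p) q = drop-length-++ p q

μ-split : ∀ m w {p q} → μ w ≡ p ++ q → length p ≡ m * 4
        → μ (take m w) ≡ p × μ (drop m w) ≡ q
μ-split m w {p} {q} μw≡pq |p|≡4m =
    (begin
      μ (take m w)               ≡⟨ sym (μ-take m w) ⟩
      take (m * 4) (μ w)         ≡⟨ cong₂ take (sym |p|≡4m) μw≡pq ⟩
      take (length p) (p ++ q)   ≡⟨ take-length-++ p q ⟩
      p                          ∎)
  , (begin
      μ (drop m w)               ≡⟨ sym (μ-drop m w) ⟩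
      drop (m * 4) (μ w)         ≡⟨ cong₂ drop (sym |p|≡4m) μw≡pq ⟩
      drop (length p) (p ++ q)   ≡⟨ drop-length-++ p q ⟩
      q                          ∎)
  where open ≡-Reasoning

μ-factorization : ∀ w us → PalFact w us → ZeroDecomp (μ w) (map μ us)
μ-factorization w []       (refl , [] , []) = (refl , [] , []) , []
μ-factorization w (u ∷ us) (refl , ne ∷ nes , pal ∷ pals)
  with μ-factorization (concat us) us (refl , nes , pals)
... | (concat≡ , nes′ , pals′) , fours =
      ( trans (cong (μ u ++_) concat≡) (sym (μ-++ u (concat us)))
      , μ-nonEmpty u ne ∷ nes′
      , μ-palindrome u pal ∷ pals′ )
    , divides (length u) (μ-length u) ∷ fours

μ-decomposition⁻ : ∀ w ws → ZeroDecomp (μ w) ws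
                 → Σ (List Word) λ us → PalFact w us × length us ≡ length ws
μ-decomposition⁻ w [] (([]≡μw , [] , []) , []) =
  [] , (sym (μ-injective w [] (sym []≡μw)) , [] , []) , refl
μ-decomposition⁻ w (p ∷ ps) ((concat≡ , ne ∷ nes , pal ∷ pals) , divides m |p|≡4m ∷ fours)
  with μ-split m w (sym concat≡) |p|≡4m
... | μhead≡p , μrest≡ps
  with μ-decomposition⁻ (drop m w) ps ((sym μrest≡ps , nes , pals) , fours)
... | us , (concat-us≡ , nes′ , pals′) , length≡ =
      take m w ∷ us
    , ( trans (cong (take m w ++_) concat-us≡) (take++drop≡id m w)
      , (λ head≡[] → ne (trans (sym μhead≡p) (cong μ head≡[]))) ∷ nes′
      , μ-palindrome⁻ (take m w) (subst Palindrome (sym μhead≡p) pal) ∷ pals′ )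
    , cong suc length≡

IsPPL0 : Word → ℕ → Set
IsPPL0 w k = (Σ (List Word) λ ws → ZeroDecomp w ws × length ws ≡ k)
           × (∀ ws → ZeroDecomp w ws → k ≤ length ws)

ppl-μ : ∀ {w k k₀} → IsPPL w k → IsPPL0 (μ w) k₀ → k ≡ k₀
ppl-μ {w} ((us , fact , refl) , minimal) ((ws , decomp , refl) , minimal₀) =
  ≤-antisym ppl≤ppl0 ppl0≤ppl
  where
  ppl≤ppl0 : length us ≤ length ws
  ppl≤ppl0 with μ-decomposition⁻ w ws decomp
  ... | vs , fact′ , length≡ = subst (length us ≤_) length≡ (minimal vs fact′)

  ppl0≤ppl : length ws ≤ length us
  ppl0≤ppl = subst (length ws ≤_) (length-map μ us)
                   (minimal₀ (map μ us) (μ-factorization w us fact))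

-- A 0-decomposition is a palindromic factorization, so PPL(v) ≤ PPL⁰(v).
ppl≤ppl0 : ∀ {v k k₀} → IsPPL0 v k₀ → IsPPL v k → k ≤ k₀
ppl≤ppl0 ((ws , decomp , refl) , _) (_ , minimal) = minimal ws (proj₁ decomp)

-- The iterates μᵐ(a); by definition t i is letter i of T (i + 1).
T : ℕ → Word
T m = μ^ m (a ∷ [])

T-head : ∀ n → Σ Word λ r → T n ≡ a ∷ r
T-head zero = [] , refl
T-head (suc n) with T-head n
... | r , T≡ = b ∷ b ∷ a ∷ μ r , cong μ T≡

T-prefix : ∀ {m n} → m ≤ n → Σ Word λ r → T n ≡ T m ++ r
T-prefix {zero} {n} z≤n = T-head n
T-prefix {suc m} (s≤s m≤n) with T-prefix m≤n
... | r , T≡ = μ r , trans (cong μ T≡) (μ-++ (T m) r)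

nth-++ : ∀ u v i → i < length u → nth (u ++ v) i ≡ nth u i
nth-++ (x ∷ u) v zero    _         = refl
nth-++ (x ∷ u) v (suc i) (s≤s i<u) = nth-++ u v i i<u

T-nth-stable : ∀ {m n} i → m ≤ n → i < length (T m) → nth (T n) i ≡ nth (T m) i
T-nth-stable {m} i m≤n i<Tm with T-prefix m≤n
... | r , T≡ = trans (cong (λ w → nth w i) T≡) (nth-++ (T m) r i i<Tm)

T-coherent : ∀ m n i → i < length (T m) → i < length (T n) → nth (T m) i ≡ nth (T n) i
T-coherent m n i i<Tm i<Tn with ≤-total m n
... | inj₁ m≤n = sym (T-nth-stable i m≤n i<Tm)
... | inj₂ n≤m = T-nth-stable i n≤m i<Tn

-- T m is long enough to contain position m (its length is 4^m).
T-long : ∀ m → m < length (T m)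
T-long zero    = s≤s z≤n
T-long (suc m) = subst (suc m <_) (sym (μ-length (T m))) (quadruple (T-long m))
  where
  quadruple : ∀ {i L} → i < L → suc i < L * 4
  quadruple {L = suc L} i<L = ≤-<-trans i<L (m<m*n (suc L) 4 (s≤s (s≤s z≤n)))

t-from : ∀ m i → i < length (T m) → t i ≡ nth (T m) i
t-from m i = T-coherent (suc i) m i (<-trans (n<1+n i) (T-long (suc i)))

μ-block : ∀ w i → i < length w → applyUpTo (λ j → nth (μ w) (i * 4 + j)) 4 ≡ μ-letter (nth w i)
μ-block (a ∷ w) zero    _         = refl
μ-block (b ∷ w) zero    _         = refl
μ-block (a ∷ w) (suc i) (s≤s i<w) = μ-block w i i<w
μ-block (b ∷ w) (suc i) (s≤s i<w) = μ-block w i i<w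

block-bound : ∀ {i L j} → i < L → j < 4 → i * 4 + j < L * 4
block-bound {i} {L} {j} i<L j<4 = begin-strict
  i * 4 + j   <⟨ +-monoʳ-< (i * 4) j<4 ⟩
  i * 4 + 4   ≡⟨ +-comm (i * 4) 4 ⟩
  suc i * 4   ≤⟨ *-monoˡ-≤ 4 i<L ⟩
  L * 4       ∎
  where open ≤-Reasoning

applyUpTo-cong : ∀ n {f g : ℕ → Letter} → (∀ j → j < n → f j ≡ g j) → applyUpTo f n ≡ applyUpTo g n
applyUpTo-cong zero    f≗g = refl
applyUpTo-cong (suc n) f≗g =
  cong₂ _∷_ (f≗g 0 (s≤s z≤n)) (applyUpTo-cong n (λ j j<n → f≗g (suc j) (s≤s j<n)))

-- t is a fixed point of μ: its i-th block of four letters is μ (t i).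
t-block : ∀ i → applyUpTo (λ j → t (i * 4 + j)) 4 ≡ μ-letter (t i)
t-block i = begin
  applyUpTo (λ j → t (i * 4 + j)) 4                    ≡⟨ applyUpTo-cong 4 read-T ⟩
  applyUpTo (λ j → nth (μ (T (suc i))) (i * 4 + j)) 4   ≡⟨ μ-block (T (suc i)) i i<T ⟩
  μ-letter (nth (T (suc i)) i)                         ≡⟨ cong μ-letter (sym (t-from (suc i) i i<T)) ⟩
  μ-letter (t i)                                       ∎
  where
  open ≡-Reasoning
  i<T : i < length (T (suc i))
  i<T = <-trans (n<1+n i) (T-long (suc i))
  read-T : ∀ j → j < 4 → t (i * 4 + j) ≡ nth (μ (T (suc i))) (i * 4 + j)
  read-T j j<4 = t-from (suc (suc i)) (i * 4 + j)
    (subst (i * 4 + j <_) (sym (μ-length (T (suc i)))) (block-bound i<T j<4))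

applyUpTo-μ : ∀ (f g : ℕ → Letter) → (∀ i → applyUpTo (λ j → g (i * 4 + j)) 4 ≡ μ-letter (f i))
            → ∀ n → applyUpTo g (n * 4) ≡ μ (applyUpTo f n)
applyUpTo-μ f g blocks zero    = refl
applyUpTo-μ f g blocks (suc n) =
  cong₂ _++_ (blocks 0) (applyUpTo-μ (f ∘ suc) (g ∘ (4 +_)) (blocks ∘ suc) n)

prefix-μ : ∀ n → prefix (4 * n) ≡ μ (prefix n)
prefix-μ n = begin
  map t (upTo (4 * n))     ≡⟨ cong (λ m → map t (upTo m)) (*-comm 4 n) ⟩
  map t (upTo (n * 4))     ≡⟨ map-applyUpTo id t (n * 4) ⟩
  applyUpTo t (n * 4)      ≡⟨ applyUpTo-μ t t t-block n ⟩
  μ (applyUpTo t n)        ≡⟨ cong μ (sym (map-applyUpTo id t n)) ⟩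
  μ (map t (upTo n))       ∎
  where open ≡-Reasoning

-- Both claims for w = t(0..n], using t(0..4n] = μ(t(0..n]).
proposition7 : ∀ (n : ℕ) → n ≥ 1 → ∀ (k k₀ k′ : ℕ)
               → PPL-is n k → PPL0-is (4 * n) k₀ → PPL-is (4 * n) k′
               → (k ≡ k₀) × (k₀ ≥ k′)
proposition7 n _ k k₀ k′ ppl ppl0 ppl′ =
    ppl-μ ppl (subst (λ w → IsPPL0 w k₀) (prefix-μ n) ppl0)
  , ppl≤ppl0 ppl0 ppl′
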